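{- Suppose the sequent $\Gamma,A\vee B$ is minimal and neither $\Gamma,A$ nor $\Gamma,B$ is valid. Then the sequent $\Gamma,A,B$ is minimal.
   Context: Formulas are built from literals, namely propositional variables $P$ and their complements $\bar P$, using $\wedge$ and $\vee$. A sequent is a nonempty finite multiset of formulas, and a comma denotes multiset union. A sequent $A_1,\dots,A_n$ is valid if $A_1\vee\cdots\vee A_n$ evaluates to $1$ under every $0/1$-assignment, with $\bar P$ read as the complement of $P$. A subsequent is obtained by deleting zero or more formulas, and it is proper if at least one formula is deleted. A sequent is minimal if it is valid and no proper subsequent of it is valid. -}

module Defs where

open import Data.Nat using (ℕ; _<_)
open import Data.Bool using (Bool; true; false; not; _∧_; _∨_)
open import Data.List using (List; []; _∷_; length; _++_; [_])
open import Data.Bool.ListAction using (any)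
open import Data.List.Relation.Binary.Sublist.Propositional using (_⊆_)
open import Relation.Binary.PropositionalEquality using (_≡_; _≢_)
open import Relation.Nullary using (¬_)
open import Data.Product using (_×_)

data Formula : Set where
  pos  : ℕ → Formula
  neg  : ℕ → Formula
  _∧ᶠ_ : Formula → Formula → Formula
  _∨ᶠ_ : Formula → Formula → Formula

Assignment : Set
Assignment = ℕ → Bool

eval : Assignment → Formula → Bool
eval ρ (pos p)   = ρ p
eval ρ (neg p)   = not (ρ p)
eval ρ (A ∧ᶠ B)  = eval ρ A ∧ eval ρ B
eval ρ (A ∨ᶠ B)  = eval ρ A ∨ eval ρ B

-- A sequent is a nonempty finite multiset of formulas, represented as a list
-- (order is irrelevant for all notions below); comma = list concatenation.
Sequent : Set
Sequent = List Formula

evalSeq : Assignment → Sequent → Bool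
evalSeq ρ Γ = any (eval ρ) Γ

Valid : Sequent → Set
Valid Γ = (ρ : Assignment) → evalSeq ρ Γ ≡ true

ProperSub : Sequent → Sequent → Set
ProperSub Δ Γ = (Δ ⊆ Γ) × (length Δ < length Γ) × (Δ ≢ [])

Minimal : Sequent → Set
Minimal Γ = (Γ ≢ []) × Valid Γ × ((Δ : Sequent) → ProperSub Δ Γ → ¬ Valid Δ)

-- Γ,A,B and Γ,A∨B are true under exactly the same assignments, so Γ,A,B is valid.
-- A valid proper subsequent Δ,Δ' (Δ ⊆ Γ, Δ' ⊆ A,B) cannot omit A or B, since it
-- would then weaken to the invalid Γ,B or Γ,A; so it is Δ,A,B with Δ shorter than
-- Γ, and then Δ,A∨B would be a valid proper subsequent of the minimal Γ,A∨B.
module Submission where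

open import Defs
open import Data.Bool using (true; false; _∨_)
open import Data.Bool.Properties using (T-≡; ∨-assoc)
open import Data.List using (List; _++_; _∷_; []; length)
open import Data.List.Properties using (++-conicalʳ; length-++)
open import Data.List.Relation.Binary.Sublist.Propositional
  using (_⊆_; []; _∷_; _∷ʳ_; ⊆-refl; minimum)
open import Data.List.Relation.Binary.Sublist.Propositional.Properties
  using (Any-resp-⊆; ++⁺)
open import Data.List.Relation.Unary.Any.Properties using (any⁺; any⁻)
open import Data.Nat using (_<_)
open import Data.Nat.Properties using (+-cancelʳ-<; +-monoˡ-<)
open import Data.Product using (∃₂; _×_; _,_)
open import Data.Sum using (_⊎_; inj₁; inj₂)
open import Function using (_⇔_; mk⇔; Equivalence)
open import Relation.Binary.PropositionalEquality
  using (_≡_; _≢_; refl; cong; sym; trans; subst₂)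
open import Relation.Nullary using (¬_)

++-∷-≢-[] : ∀ {X : Set} (xs : List X) {y : X} {ys : List X} → xs ++ y ∷ ys ≢ []
++-∷-≢-[] xs e with ++-conicalʳ xs _ e
... | ()

⊆-++-split : ∀ {X : Set} (Γ : List X) {R Δ : List X} → Δ ⊆ Γ ++ R →
             ∃₂ λ Δ₁ Δ₂ → Δ₁ ⊆ Γ × Δ₂ ⊆ R × Δ ≡ Δ₁ ++ Δ₂
⊆-++-split []      Δ⊆R = [] , _ , [] , Δ⊆R , refl
⊆-++-split (x ∷ Γ) (.x ∷ʳ Δ⊆) with ⊆-++-split Γ Δ⊆
... | Δ₁ , Δ₂ , Δ₁⊆Γ , Δ₂⊆R , refl = Δ₁ , Δ₂ , x ∷ʳ Δ₁⊆Γ , Δ₂⊆R , refl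
⊆-++-split (x ∷ Γ) (refl ∷ Δ⊆) with ⊆-++-split Γ Δ⊆
... | Δ₁ , Δ₂ , Δ₁⊆Γ , Δ₂⊆R , refl = x ∷ Δ₁ , Δ₂ , refl ∷ Δ₁⊆Γ , Δ₂⊆R , refl

⊆-pair : ∀ {X : Set} {a b : X} {xs : List X} → xs ⊆ a ∷ b ∷ [] →
         xs ⊆ a ∷ [] ⊎ xs ⊆ b ∷ [] ⊎ xs ≡ a ∷ b ∷ []
⊆-pair (_ ∷ʳ _ ∷ʳ [])     = inj₁ (minimum _)
⊆-pair (_ ∷ʳ refl ∷ [])   = inj₂ (inj₁ ⊆-refl)
⊆-pair (refl ∷ _ ∷ʳ [])   = inj₁ ⊆-refl
⊆-pair (refl ∷ refl ∷ []) = inj₂ (inj₂ refl)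

length-++-cancelʳ-< : ∀ {X : Set} (xs ys zs : List X) →
                      length (xs ++ zs) < length (ys ++ zs) → length xs < length ys
length-++-cancelʳ-< xs ys zs lt =
  +-cancelʳ-< (length zs) (length xs) (length ys)
    (subst₂ _<_ (length-++ xs) (length-++ ys) lt)

length-++-monoˡ-< : ∀ {X : Set} (xs ys zs : List X) →
                    length xs < length ys → length (xs ++ zs) < length (ys ++ zs)
length-++-monoˡ-< xs ys zs lt =
  subst₂ _<_ (sym (length-++ xs)) (sym (length-++ ys)) (+-monoˡ-< (length zs) lt)

ProperSub-++⁺ : ∀ {Δ Γ : Sequent} {A : Formula} {R : Sequent} →
                Δ ⊆ Γ → length Δ < length Γ → ProperSub (Δ ++ A ∷ R) (Γ ++ A ∷ R)
ProperSub-++⁺ {Δ} {Γ} Δ⊆Γ lt = ++⁺ Δ⊆Γ ⊆-refl , length-++-monoˡ-< Δ Γ _ lt , ++-∷-≢-[] Δ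

evalSeq-mono : ∀ ρ {Δ Γ : Sequent} → Δ ⊆ Γ → evalSeq ρ Δ ≡ true → evalSeq ρ Γ ≡ true
evalSeq-mono ρ {Δ} Δ⊆Γ holds = Equivalence.to T-≡
  (any⁺ (eval ρ) (Any-resp-⊆ Δ⊆Γ (any⁻ (eval ρ) Δ (Equivalence.from T-≡ holds))))

Valid-mono : ∀ {Δ Γ : Sequent} → Δ ⊆ Γ → Valid Δ → Valid Γ
Valid-mono Δ⊆Γ valid ρ = evalSeq-mono ρ Δ⊆Γ (valid ρ)

evalSeq-∨ᶠ-split : ∀ ρ (Γ : Sequent) A B →
                   evalSeq ρ (Γ ++ A ∷ B ∷ []) ≡ evalSeq ρ (Γ ++ (A ∨ᶠ B) ∷ [])
evalSeq-∨ᶠ-split ρ []      A B = sym (∨-assoc (eval ρ A) (eval ρ B) false)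
evalSeq-∨ᶠ-split ρ (C ∷ Γ) A B = cong (eval ρ C ∨_) (evalSeq-∨ᶠ-split ρ Γ A B)

Valid-∨ᶠ-split : ∀ (Γ : Sequent) A B → Valid (Γ ++ A ∷ B ∷ []) ⇔ Valid (Γ ++ (A ∨ᶠ B) ∷ [])
Valid-∨ᶠ-split Γ A B = mk⇔
  (λ valid ρ → trans (sym (evalSeq-∨ᶠ-split ρ Γ A B)) (valid ρ))
  (λ valid ρ → trans (evalSeq-∨ᶠ-split ρ Γ A B) (valid ρ))

lemma6 : (Γ : List Formula) (A B : Formula) →
           Minimal (Γ ++ (A ∨ᶠ B) ∷ []) →
           ¬ Valid (Γ ++ A ∷ []) →
           ¬ Valid (Γ ++ B ∷ []) →
           Minimal (Γ ++ A ∷ B ∷ [])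
lemma6 Γ A B (_ , valid , minimal) ¬validA ¬validB =
  ++-∷-≢-[] Γ , Equivalence.from (Valid-∨ᶠ-split Γ A B) valid , noValidProperSub
  where
  noValidProperSub : (Δ : Sequent) → ProperSub Δ (Γ ++ A ∷ B ∷ []) → ¬ Valid Δ
  noValidProperSub Δ (Δ⊆ , shorter , _) validΔ with ⊆-++-split Γ Δ⊆
  ... | Δ₁ , Δ₂ , Δ₁⊆Γ , Δ₂⊆AB , refl with ⊆-pair Δ₂⊆AB
  ... | inj₁ Δ₂⊆A        = ¬validA (Valid-mono (++⁺ Δ₁⊆Γ Δ₂⊆A) validΔ)
  ... | inj₂ (inj₁ Δ₂⊆B) = ¬validB (Valid-mono (++⁺ Δ₁⊆Γ Δ₂⊆B) validΔ)
  ... | inj₂ (inj₂ refl) =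
    minimal (Δ₁ ++ (A ∨ᶠ B) ∷ [])
      (ProperSub-++⁺ Δ₁⊆Γ (length-++-cancelʳ-< Δ₁ Γ _ shorter))
      (Equivalence.to (Valid-∨ᶠ-split Δ₁ A B) validΔ)
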